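{- Let $\Delta$ be a visibly BPA. For all $X,X'\in\Gamma$ and $\alpha,\alpha'\in\Gamma^*$, we have $X\alpha\sim X'\alpha'$ if and only if (i) $X\sim X'$, and (ii) if $X\to^*\epsilon$ or $X'\to^*\epsilon$, then $\alpha\sim\alpha'$.
   Context: A visibly BPA (vBPA) over actions $\mathit{Act}=\mathit{Act}_c\cup\mathit{Act}_r\cup\mathit{Act}_i$ (disjoint call, return, internal actions) and finite stack alphabet $\Gamma$ is a finite set $\Delta$ of rules $X\xrightarrow{a}\alpha$ ($X\in\Gamma$, $\alpha\in\Gamma^*$) with $|\alpha|=2$ if $a\in\mathit{Act}_c$, $|\alpha|=0$ if $a\in\mathit{Act}_r$, $|\alpha|=1$ if $a\in\mathit{Act}_i$; it generates the labelled transition system on states $\Gamma^*$ with $X\gamma\xrightarrow{a}\alpha\gamma$ for every rule $X\xrightarrow{a}\alpha$ and $\gamma\in\Gamma^*$ (top of stack leftmost). $X\to^*\epsilon$ means the empty stack $\epsilon$ is reachable from $X$ by a finite sequence of transitions. $\sim$ denotes bisimilarity: $s\sim t$ iff some relation $R$ with $(s,t)\in R$ satisfies $R=R^{ -1}$ and, for all $(s,t)\in R$ and $s\xrightarrow{a}s'$, there is $t\xrightarrow{a}t'$ with $(s',t')\in R$. -}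

module Defs where

open import Level using (Level; 0ℓ) renaming (suc to lsuc)
open import Data.Nat using (ℕ)
open import Data.Fin using (Fin)
open import Data.Sum using (_⊎_; inj₁; inj₂)
open import Data.Product using (Σ; ∃; _×_; _,_)
open import Data.List using (List; []; _∷_; _++_)
open import Data.List.Membership.Propositional using (_∈_)
open import Relation.Binary.PropositionalEquality using (_≡_)
open import Relation.Binary.Construct.Closure.ReflexiveTransitive using (Star)

module VBPA (nc nr ni n : ℕ) where

  Act : Set
  Act = Fin nc ⊎ (Fin nr ⊎ Fin ni)

  Γ : Set
  Γ = Fin n

  -- A rule X --a--> α with the arity constraint of a visibly BPA built in:
  -- call actions push two symbols, return actions pop, internal replace by one.
  data Rule : Set where
    callR : Γ → Fin nc → Γ → Γ → Rule
    retR  : Γ → Fin nr → Rule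
    intR  : Γ → Fin ni → Γ → Rule

  lhs : Rule → Γ
  lhs (callR X _ _ _) = X
  lhs (retR X _)      = X
  lhs (intR X _ _)    = X

  act : Rule → Act
  act (callR _ a _ _) = inj₁ a
  act (retR _ a)      = inj₂ (inj₁ a)
  act (intR _ a _)    = inj₂ (inj₂ a)

  rhs : Rule → List Γ
  rhs (callR _ _ Y Z) = Y ∷ Z ∷ []
  rhs (retR _ _)      = []
  rhs (intR _ _ Y)    = Y ∷ []

  VBPA : Set
  VBPA = List Rule

  -- Transition relation on states Γ* (top of stack = head of list):
  -- X γ --a--> α γ for every rule X --a--> α in Δ.
  data Step (Δ : VBPA) : List Γ → Act → List Γ → Set where
    step : ∀ (r : Rule) (γ : List Γ) → r ∈ Δ →
           Step Δ (lhs r ∷ γ) (act r) (rhs r ++ γ)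

  AnyStep : VBPA → List Γ → List Γ → Set
  AnyStep Δ s s' = ∃ λ a → Step Δ s a s'

  Reach : VBPA → List Γ → List Γ → Set
  Reach Δ = Star (AnyStep Δ)

  IsSymBisim : VBPA → (List Γ → List Γ → Set) → Set
  IsSymBisim Δ R =
    (∀ s t → R s t → R t s) ×
    (∀ s t → R s t → ∀ a s' → Step Δ s a s' →
       ∃ λ t' → Step Δ t a t' × R s' t')

  Bisim : VBPA → List Γ → List Γ → Set₁
  Bisim Δ s t = Σ (List Γ → List Γ → Set) λ R → IsSymBisim Δ R × R s t

-- Visibility makes the stack heights of two bisimilar configurations move in lockstep: the
-- action of a step alone determines how the height changes. Hence if R relates Xα and X'α',
-- the pairs (β, β') of equal height with βα R β'α' form a simulation in which the suffixes α,
-- α' are never touched; this gives X ∼ X', and when X empties its stack X' empties it in the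
-- same step, leaving α R α'. Conversely, relate βα to β'α' whenever β ∼ β' have equal height
-- and are reachable from X or X'; steps stay inside the prefixes until both empty at once,
-- which means X or X' reaches ε, and from then on α ∼ α' takes over.
module Submission where

open import Defs
open import Level using (0ℓ)
open import Data.Nat using (ℕ; suc; _+_)
open import Data.Nat.Properties using (suc-injective; +-suc)
open import Data.Sum as Sum using (_⊎_; inj₁; inj₂; [_,_]′)
open import Data.Product using (_×_; _,_; ∃; proj₁; proj₂; map₁; map₂; uncurry)
open import Data.List using (List; []; _∷_; _++_; length)
open import Data.List.Properties using (++-assoc; length-++)
open import Function.Base using (flip; id; _∘_)
open import Function.Bundles using (_⇔_; mk⇔)
open import Relation.Binary.Core using (Rel; _⇒_)
open import Relation.Binary.PropositionalEquality using (_≡_; refl; sym; trans; cong; module ≡-Reasoning)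
open import Relation.Binary.Construct.Closure.ReflexiveTransitive using (ε; _◅_; _◅◅_)
open import Relation.Binary.Construct.Closure.Symmetric as SymClosure using (SymClosure; fwd; bwd)
open import Relation.Binary.Construct.Union using (_∪_)

module _ {nc nr ni n : ℕ} (Δ : VBPA.VBPA nc nr ni n) where
  open VBPA nc nr ni n

  arity : Act → ℕ
  arity (inj₁ _)        = 2
  arity (inj₂ (inj₁ _)) = 0
  arity (inj₂ (inj₂ _)) = 1

  length-rhs : ∀ r → length (rhs r) ≡ arity (act r)
  length-rhs (callR _ _ _ _) = refl
  length-rhs (retR _ _)      = refl
  length-rhs (intR _ _ _)    = refl

  step-length : ∀ {s a u} → Step Δ s a u → suc (length u) ≡ arity a + length s
  step-length (step r γ _) = begin
    suc (length (rhs r ++ γ))        ≡⟨ cong suc (length-++ (rhs r)) ⟩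
    suc (length (rhs r) + length γ)  ≡⟨ cong (λ k → suc (k + length γ)) (length-rhs r) ⟩
    suc (arity (act r) + length γ)   ≡⟨ sym (+-suc (arity (act r)) (length γ)) ⟩
    arity (act r) + suc (length γ)   ∎
    where open ≡-Reasoning

  -- Where the visibility of Δ enters.
  step-length-≡ : ∀ {s t a u v} → Step Δ s a u → Step Δ t a v →
                  length s ≡ length t → length u ≡ length v
  step-length-≡ {a = a} s→u t→v |s|≡|t| =
    suc-injective (trans (step-length s→u) (trans (cong (arity a +_) |s|≡|t|) (sym (step-length t→v))))

  step-++ʳ : ∀ {s a u} δ → Step Δ s a u → Step Δ (s ++ δ) a (u ++ δ)
  step-++ʳ δ (step r γ r∈Δ) rewrite ++-assoc (rhs r) γ δ = step r (γ ++ δ) r∈Δ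

  step-++⁻ : ∀ {Y γ a v} δ → Step Δ (Y ∷ γ ++ δ) a v → ∃ λ u → Step Δ (Y ∷ γ) a u × v ≡ u ++ δ
  step-++⁻ {γ = γ} δ (step r _ r∈Δ) = rhs r ++ γ , step r γ r∈Δ , sym (++-assoc (rhs r) γ δ)

  Progress : Rel (List Γ) 0ℓ → Rel (List Γ) 0ℓ → Set
  Progress R S = ∀ s t → R s t → ∀ a s' → Step Δ s a s' → ∃ λ t' → Step Δ t a t' × S s' t'

  progress-⊆ : ∀ {R R' S S'} → R ⇒ R' → Progress R' S' → S' ⇒ S → Progress R S
  progress-⊆ R⇒R' progress S'⇒S s t r a s' s→s' = map₂ (map₂ S'⇒S) (progress s t (R⇒R' r) a s' s→s')

  symClosure-∪-isSymBisim : ∀ {R B} → Progress R (R ∪ B) → Progress (flip R) (flip R ∪ B) →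
                            IsSymBisim Δ B → IsSymBisim Δ (SymClosure R ∪ B)
  symClosure-∪-isSymBisim {R} {B} progressR progressR˘ (B-sym , progressB) =
    symmetric , progress
    where
    symmetric : ∀ s t → (SymClosure R ∪ B) s t → (SymClosure R ∪ B) t s
    symmetric s t = Sum.map (SymClosure.symmetric R) (B-sym s t)

    progress : Progress (SymClosure R ∪ B) (SymClosure R ∪ B)
    progress s t (inj₁ (fwd r)) a s' s→s' = map₂ (map₂ (Sum.map₁ fwd)) (progressR s t r a s' s→s')
    progress s t (inj₁ (bwd r)) a s' s→s' = map₂ (map₂ (Sum.map₁ bwd)) (progressR˘ s t r a s' s→s')
    progress s t (inj₂ b)       a s' s→s' = map₂ (map₂ inj₂) (progressB s t b a s' s→s')

  progress-reach : ∀ {K s t s'} → Progress K K → K s t → Reach Δ s s' → ∃ λ t' → Reach Δ t t' × K s' t'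
  progress-reach progress k ε = _ , ε , k
  progress-reach progress k ((a , s→s₁) ◅ s₁→*s') with progress _ _ k a _ s→s₁
  ... | t₁ , t→t₁ , k₁ = map₂ (map₁ ((a , t→t₁) ◅_)) (progress-reach progress k₁ s₁→*s')

  Bisim-sym : ∀ {s t} → Bisim Δ s t → Bisim Δ t s
  Bisim-sym (R , R-bisim@(R-sym , _) , r) = R , R-bisim , R-sym _ _ r

  record Unframed (R : Rel (List Γ) 0ℓ) (α α' β β' : List Γ) : Set where
    constructor unframed
    field
      length-≡ : length β ≡ length β'
      related  : R (β ++ α) (β' ++ α')

  unframed-flip : ∀ {R α α' β β'} → (∀ s t → R s t → R t s) →
                  Unframed R α α' β β' → Unframed R α' α β' β
  unframed-flip R-sym (unframed |β|≡|β'| r) = unframed (sym |β|≡|β'|) (R-sym _ _ r)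

  unframed-progress : ∀ {R} α α' → Progress R R → Progress (Unframed R α α') (Unframed R α α')
  unframed-progress α α' progressR (_ ∷ _) (_ ∷ _) (unframed |β|≡|β'| r) a u β→u
    with _ , β'α'→ , r' ← progressR _ _ r a (u ++ α) (step-++ʳ α β→u)
    with u' , β'→u' , refl ← step-++⁻ α' β'α'→
    = u' , β'→u' , unframed (step-length-≡ β→u β'→u' |β|≡|β'|) r'
  unframed-progress α α' progressR (_ ∷ _) [] (unframed () _) a u β→u

  unframed-reach-[] : ∀ {R β β'} α α' → Progress R R → Unframed R α α' β β' → Reach Δ β [] → R α α'
  unframed-reach-[] α α' progressR k β→*[]
    with [] , _ , unframed _ r ← progress-reach (unframed-progress α α' progressR) k β→*[]
    = r

  bisim-head : ∀ {X X' α α'} → Bisim Δ (X ∷ α) (X' ∷ α') → Bisim Δ (X ∷ []) (X' ∷ [])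
  bisim-head {α = α} {α'} (R , R-bisim@(R-sym , progressR) , r) =
    SymClosure (Unframed R α α') ∪ R ,
    symClosure-∪-isSymBisim
      (progress-⊆ id (unframed-progress α α' progressR) inj₁)
      (progress-⊆ (unframed-flip R-sym) (unframed-progress α' α progressR) (inj₁ ∘ unframed-flip R-sym))
      R-bisim ,
    inj₁ (fwd (unframed refl r))

  bisim-tail : ∀ {X X' α α'} → Bisim Δ (X ∷ α) (X' ∷ α') → Reach Δ (X ∷ []) [] → Bisim Δ α α'
  bisim-tail {α = α} {α'} (R , R-bisim@(_ , progressR) , r) X→*[] =
    R , R-bisim , unframed-reach-[] α α' progressR (unframed refl r) X→*[]

  bisim-uncons : ∀ {X X' α α'} → Bisim Δ (X ∷ α) (X' ∷ α') →
                 Bisim Δ (X ∷ []) (X' ∷ []) × (Reach Δ (X ∷ []) [] ⊎ Reach Δ (X' ∷ []) [] → Bisim Δ α α')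
  bisim-uncons b =
    bisim-head b , [ bisim-tail b , (λ X'→*[] → Bisim-sym (bisim-tail (Bisim-sym b) X'→*[])) ]′

  data Framed (K : Rel (List Γ) 0ℓ) (α α' : List Γ) : Rel (List Γ) 0ℓ where
    frame : ∀ {β β'} → K β β' → Framed K α α' (β ++ α) (β' ++ α')

  framed-flip : ∀ {K α α' s t} → (∀ {β β'} → K β β' → K β' β) → Framed K α α' s t → Framed K α' α t s
  framed-flip K-sym (frame k) = frame (K-sym k)

  framed-progress : ∀ {K B α α'} → Progress K K → (∀ {β β'} → K β β' → length β ≡ length β') →
                    Progress B B → (K [] [] → B α α') → Progress (Framed K α α') (Framed K α α' ∪ B)
  framed-progress progressK K-length progressB K[][]⇒B _ _ (frame {[]} {[]} k) a s' s→s' =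
    map₂ (map₂ inj₂) (progressB _ _ (K[][]⇒B k) a s' s→s')
  framed-progress progressK K-length progressB K[][]⇒B _ _ (frame {[]} {_ ∷ _} k) a s' s→s'
    with () ← K-length k
  framed-progress {α = α} {α'} progressK K-length progressB K[][]⇒B _ _ (frame {_ ∷ _} k) a _ s→s'
    with u , β→u , refl ← step-++⁻ α s→s'
    with u' , β'→u' , k' ← progressK _ _ k a u β→u
    = u' ++ α' , step-++ʳ α' β'→u' , inj₁ (frame k')

  FromRoots : Γ → Γ → List Γ → Set
  FromRoots X X' γ = Reach Δ (X ∷ []) γ ⊎ Reach Δ (X' ∷ []) γ

  fromRoots-step : ∀ {X X' γ a u} → FromRoots X X' γ → Step Δ γ a u → FromRoots X X' u
  fromRoots-step γ∈ γ→u = Sum.map (_◅◅ (_ , γ→u) ◅ ε) (_◅◅ (_ , γ→u) ◅ ε) γ∈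

  -- The roots are kept so that a pair of prefixes emptying together witnesses X →* ε or X' →* ε.
  record Rooted (R : Rel (List Γ) 0ℓ) (X X' : Γ) (β β' : List Γ) : Set where
    constructor rooted
    field
      related  : R β β'
      length-≡ : length β ≡ length β'
      root     : FromRoots X X' β
      root'    : FromRoots X X' β'

  rooted-flip : ∀ {R X X' β β'} → (∀ s t → R s t → R t s) → Rooted R X X' β β' → Rooted R X X' β' β
  rooted-flip R-sym (rooted r |β|≡|β'| d d') = rooted (R-sym _ _ r) (sym |β|≡|β'|) d' d

  rooted-progress : ∀ {R X X'} → Progress R R → Progress (Rooted R X X') (Rooted R X X')
  rooted-progress progressR β β' (rooted r |β|≡|β'| d d') a u β→u
    with u' , β'→u' , r' ← progressR β β' r a u β→u
    = u' , β'→u' ,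
      rooted r' (step-length-≡ β→u β'→u' |β|≡|β'|) (fromRoots-step d β→u) (fromRoots-step d' β'→u')

  -- Reaching ε is not decidable, so the bisimulations for α ∼ α' promised by each witness are
  -- used all at once.
  ⋃ : ∀ {P : Set} {s₀ t₀} → (P → Bisim Δ s₀ t₀) → Rel (List Γ) 0ℓ
  ⋃ H s t = ∃ λ p → proj₁ (H p) s t

  ⋃-isSymBisim : ∀ {P : Set} {s₀ t₀} (H : P → Bisim Δ s₀ t₀) → IsSymBisim Δ (⋃ H)
  ⋃-isSymBisim H =
    (λ s t → map₂ (λ {p} → proj₁ (proj₁ (proj₂ (H p))) s t)) ,
    λ s t (p , r) a s' s→s' → map₂ (map₂ (p ,_)) (proj₂ (proj₁ (proj₂ (H p))) s t r a s' s→s')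

  ⋃-relates : ∀ {P : Set} {s₀ t₀} (H : P → Bisim Δ s₀ t₀) → P → ⋃ H s₀ t₀
  ⋃-relates H p = p , proj₂ (proj₂ (H p))

  bisim-cons : ∀ {X X' α α'} → Bisim Δ (X ∷ []) (X' ∷ []) →
               (Reach Δ (X ∷ []) [] ⊎ Reach Δ (X' ∷ []) [] → Bisim Δ α α') → Bisim Δ (X ∷ α) (X' ∷ α')
  bisim-cons {X} {X'} {α} {α'} (R , (R-sym , progressR) , r) H =
    SymClosure (Framed K α α') ∪ ⋃ H ,
    symClosure-∪-isSymBisim
      (framed-progress progressK Rooted.length-≡ progress⋃ (⋃-relates H ∘ Rooted.root))
      (progress-⊆ (framed-flip K-sym)
        (framed-progress progressK Rooted.length-≡ progress⋃ (λ k → ⋃-sym _ _ (⋃-relates H (Rooted.root k))))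
        (Sum.map₁ (framed-flip K-sym)))
      (⋃-isSymBisim H) ,
    inj₁ (fwd (frame (rooted r refl (inj₁ ε) (inj₂ ε))))
    where
    K : Rel (List Γ) 0ℓ
    K = Rooted R X X'
    K-sym : ∀ {β β'} → K β β' → K β' β
    K-sym = rooted-flip R-sym
    progressK : Progress K K
    progressK = rooted-progress progressR
    ⋃-sym : ∀ s t → ⋃ H s t → ⋃ H t s
    ⋃-sym = proj₁ (⋃-isSymBisim H)
    progress⋃ : Progress (⋃ H) (⋃ H)
    progress⋃ = proj₂ (⋃-isSymBisim H)

lemma3p5 : (nc nr ni n : ℕ) → let open VBPA nc nr ni n in
    (Δ : VBPA) (X X' : Γ) (α α' : List Γ) →
    Bisim Δ (X ∷ α) (X' ∷ α') ⇔
      (Bisim Δ (X ∷ []) (X' ∷ []) ×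
       ((Reach Δ (X ∷ []) [] ⊎ Reach Δ (X' ∷ []) []) → Bisim Δ α α'))
lemma3p5 nc nr ni n Δ X X' α α' = mk⇔ (bisim-uncons Δ) (uncurry (bisim-cons Δ))
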